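{- For every $\sigma\in S_n$, $I^{ -1}(\mathrm{rev}(L(\sigma))) = w_0\sigma^{ -1}w_0$; that is, the composition $I^{ -1}\circ\mathrm{rev}\circ L\colon S_n\to S_n$ is the map $\sigma\mapsto w_0\sigma^{ -1}w_0$.
   Context: The Lehmer code of $\sigma\in S_n$ is $L(\sigma)=(L_1,\dots,L_n)$ with $L_i=\#\{j>i:\sigma(j)<\sigma(i)\}$; $L$ is a bijection $S_n\to[0,n-1]\times[0,n-2]\times\cdots\times[0,0]$. The inversion code is $I(\sigma)=(x_1,\dots,x_n)$ with $x_i=\#\{j<i:\sigma^{ -1}(j)>\sigma^{ -1}(i)\}$; $I$ is a bijection $S_n\to[0,0]\times[0,1]\times\cdots\times[0,n-1]$. $\mathrm{rev}(a_1,\dots,a_n)=(a_n,\dots,a_1)$. $w_0\in S_n$ is $w_0(k)=n+1-k$. -}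

module Defs where

open import Data.Nat using (ℕ; zero; suc; _+_; _<_)
open import Data.Fin using (Fin; toℕ; opposite; _<?_) renaming (_<_ to _<ᶠ_)
open import Data.Fin.Permutation using (Permutation′; _⟨$⟩ʳ_; _⟨$⟩ˡ_; _∘ₚ_; flip; permutation)
import Data.Fin.Permutation
open import Data.Vec using (Vec; tabulate; reverse; allFin)
open import Data.List using (List; length; filter)
open import Data.List.Base using ()
open import Data.Fin.Base using (Fin)
open import Relation.Nullary using (Dec)
open import Data.Product using (_×_; _,_)
open import Relation.Nullary.Decidable using (_×-dec_)

count : ∀ {n} (P : Fin n → Set) → (∀ j → Dec (P j)) → ℕ
count {n} P P? = length (filter P? (Data.List.tabulate {n = n} (λ j → j)))
  where import Data.List

L : ∀ {n} → Permutation′ n → Vec ℕ n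
L σ = tabulate λ i →
  count (λ j → (i <ᶠ j) × ((σ ⟨$⟩ʳ j) <ᶠ (σ ⟨$⟩ʳ i)))
        (λ j → (i <? j) ×-dec ((σ ⟨$⟩ʳ j) <? (σ ⟨$⟩ʳ i)))

I : ∀ {n} → Permutation′ n → Vec ℕ n
I σ = tabulate λ i →
  count (λ j → (j <ᶠ i) × ((σ ⟨$⟩ˡ i) <ᶠ (σ ⟨$⟩ˡ j)))
        (λ j → (j <? i) ×-dec ((σ ⟨$⟩ˡ i) <? (σ ⟨$⟩ˡ j)))

-- longest element w₀(k) = n+1-k  (0-indexed: k ↦ n-1-k)
w₀ : ∀ {n} → Permutation′ n
w₀ = Data.Fin.Permutation.reverse

_⁻¹ : ∀ {n} → Permutation′ n → Permutation′ n
σ ⁻¹ = flip σ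

{-# OPTIONS --safe #-}
-- The permutation w₀σ⁻¹w₀ has inverse w₀σw₀, which acts as σ with positions and values
-- reflected. Reflection reverses the order on both, so the pairs counted by I(w₀σ⁻¹w₀) at i
-- are, after reindexing by the bijection w₀, exactly the pairs counted by L(σ) at w₀(i).
module Submission where

open import Defs
import Algebra.Properties.CommutativeMonoid.Sum as CommutativeMonoidSum
open import Data.Bool.Base using (true; false; if_then_else_)
open import Data.Fin.Base using (Fin; zero; suc; opposite; fromℕ; inject₁) renaming (_<_ to _<ᶠ_)
open import Data.Fin.Permutation using (Permutation′; _∘ₚ_; _⟨$⟩ʳ_)
open import Data.Fin.Properties using (opposite-prop; opposite-involutive; toℕ<n)
open import Data.List.Base as List using (List; []; _∷_; length; filter)
open import Data.List.Properties using (map-tabulate; filter-≐)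
open import Data.Nat.Base using (ℕ; _+_; _<_; s≤s)
open import Data.Nat.Properties using (+-0-commutativeMonoid; ∸-monoʳ-<)
open import Data.Product.Base using (_×_; _,_; map)
open import Data.Vec.Base using (Vec; _∷ʳ_; lookup; tabulate; reverse)
import Data.Vec.Base as Vec
open import Data.Vec.Properties using (reverse-∷; tabulate∘lookup; lookup∘tabulate; tabulate-cong)
open import Function.Base using (_∘_; id)
open import Function.Bundles using (_⇔_; mk⇔; Equivalence)
open import Level using (Level)
open import Relation.Binary.PropositionalEquality
open import Relation.Nullary.Decidable using (Dec; does)
open import Relation.Unary using (Pred; Decidable)

open CommutativeMonoidSum +-0-commutativeMonoid using (sum; sum-permute)

private
  variable
    a p : Level
    A B : Set a
    n : ℕ

lookup-∷ʳ-fromℕ : (xs : Vec A n) (x : A) → lookup (xs ∷ʳ x) (fromℕ n) ≡ x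
lookup-∷ʳ-fromℕ Vec.[]       x = refl
lookup-∷ʳ-fromℕ (_ Vec.∷ xs) x = lookup-∷ʳ-fromℕ xs x

lookup-∷ʳ-inject₁ : (xs : Vec A n) (x : A) (i : Fin n) → lookup (xs ∷ʳ x) (inject₁ i) ≡ lookup xs i
lookup-∷ʳ-inject₁ (_ Vec.∷ xs) x zero    = refl
lookup-∷ʳ-inject₁ (_ Vec.∷ xs) x (suc i) = lookup-∷ʳ-inject₁ xs x i

lookup-reverse-opposite : (xs : Vec A n) (i : Fin n) → lookup (reverse xs) (opposite i) ≡ lookup xs i
lookup-reverse-opposite (x Vec.∷ xs) zero    rewrite reverse-∷ x xs = lookup-∷ʳ-fromℕ (reverse xs) x
lookup-reverse-opposite (x Vec.∷ xs) (suc i) rewrite reverse-∷ x xs =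
  trans (lookup-∷ʳ-inject₁ (reverse xs) x (opposite i)) (lookup-reverse-opposite xs i)

lookup-reverse : (xs : Vec A n) (i : Fin n) → lookup (reverse xs) i ≡ lookup xs (opposite i)
lookup-reverse xs i = begin
  lookup (reverse xs) i                         ≡⟨ cong (lookup (reverse xs)) (opposite-involutive i) ⟨
  lookup (reverse xs) (opposite (opposite i))   ≡⟨ lookup-reverse-opposite xs (opposite i) ⟩
  lookup xs (opposite i)                        ∎
  where open ≡-Reasoning

reverse-tabulate : (f : Fin n → A) → reverse (tabulate f) ≡ tabulate (f ∘ opposite)
reverse-tabulate f = begin
  reverse (tabulate f)                      ≡⟨ tabulate∘lookup (reverse (tabulate f)) ⟨
  tabulate (lookup (reverse (tabulate f)))  ≡⟨ tabulate-cong lookup-reverse-tabulate ⟩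
  tabulate (f ∘ opposite)                   ∎
  where
  open ≡-Reasoning
  lookup-reverse-tabulate : ∀ i → lookup (reverse (tabulate f)) i ≡ f (opposite i)
  lookup-reverse-tabulate i = trans (lookup-reverse (tabulate f) i) (lookup∘tabulate f (opposite i))

opposite-mono-< : {i j : Fin n} → i <ᶠ j → opposite j <ᶠ opposite i
opposite-mono-< {n} {i} {j} i<j =
  subst₂ _<_ (sym (opposite-prop j)) (sym (opposite-prop i)) (∸-monoʳ-< {m = n} (s≤s i<j) (toℕ<n j))

opposite-cancel-< : {i j : Fin n} → opposite i <ᶠ opposite j → j <ᶠ i
opposite-cancel-< {i = i} {j} oi<oj =
  subst₂ _<ᶠ_ (opposite-involutive j) (opposite-involutive i) (opposite-mono-< oi<oj)

indicator : {P : Set p} → Dec P → ℕ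
indicator P? = if does P? then 1 else 0

length-filter-∷ : {P : Pred A p} (P? : Decidable P) (x : A) (xs : List A) →
                  length (filter P? (x ∷ xs)) ≡ indicator (P? x) + length (filter P? xs)
length-filter-∷ P? x xs with does (P? x)
... | true  = refl
... | false = refl

length-filter-map : {P : Pred B p} (P? : Decidable P) (f : A → B) (xs : List A) →
                    length (filter P? (List.map f xs)) ≡ length (filter (P? ∘ f) xs)
length-filter-map P? f []       = refl
length-filter-map P? f (x ∷ xs) = begin
  length (filter P? (f x ∷ List.map f xs))                   ≡⟨ length-filter-∷ P? (f x) (List.map f xs) ⟩
  indicator (P? (f x)) + length (filter P? (List.map f xs))  ≡⟨ cong (indicator (P? (f x)) +_) (length-filter-map P? f xs) ⟩
  indicator (P? (f x)) + length (filter (P? ∘ f) xs)         ≡⟨ length-filter-∷ (P? ∘ f) x xs ⟨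
  length (filter (P? ∘ f) (x ∷ xs))                          ∎
  where open ≡-Reasoning

count-suc : (P : Fin (ℕ.suc n) → Set) (P? : ∀ j → Dec (P j)) →
            count P P? ≡ indicator (P? zero) + count (P ∘ suc) (P? ∘ suc)
count-suc P P? = begin
  length (filter P? (zero ∷ List.tabulate suc))                               ≡⟨ length-filter-∷ P? zero (List.tabulate suc) ⟩
  indicator (P? zero) + length (filter P? (List.tabulate suc))                ≡⟨ cong (λ xs → indicator (P? zero) + length (filter P? xs)) (map-tabulate id suc) ⟨
  indicator (P? zero) + length (filter P? (List.map suc (List.tabulate id)))  ≡⟨ cong (indicator (P? zero) +_) (length-filter-map P? suc (List.tabulate id)) ⟩
  indicator (P? zero) + count (P ∘ suc) (P? ∘ suc)                            ∎
  where open ≡-Reasoning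

count≡sum : (P : Fin n → Set) (P? : ∀ j → Dec (P j)) → count P P? ≡ sum (indicator ∘ P?)
count≡sum {ℕ.zero}  P P? = refl
count≡sum {ℕ.suc n} P P? =
  trans (count-suc P P?) (cong (indicator (P? zero) +_) (count≡sum (P ∘ suc) (P? ∘ suc)))

count-permute : (π : Permutation′ n) (P : Fin n → Set) (P? : ∀ j → Dec (P j)) →
                count P P? ≡ count (P ∘ (π ⟨$⟩ʳ_)) (P? ∘ (π ⟨$⟩ʳ_))
count-permute π P P? = begin
  count P P?                              ≡⟨ count≡sum P P? ⟩
  sum (indicator ∘ P?)                    ≡⟨ sum-permute (indicator ∘ P?) π ⟩
  sum (indicator ∘ P? ∘ (π ⟨$⟩ʳ_))        ≡⟨ count≡sum (P ∘ (π ⟨$⟩ʳ_)) (P? ∘ (π ⟨$⟩ʳ_)) ⟨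
  count (P ∘ (π ⟨$⟩ʳ_)) (P? ∘ (π ⟨$⟩ʳ_))  ∎
  where open ≡-Reasoning

count-cong : {P Q : Fin n → Set} (P? : ∀ j → Dec (P j)) (Q? : ∀ j → Dec (Q j)) →
             (∀ j → P j ⇔ Q j) → count P P? ≡ count Q Q?
count-cong P? Q? P⇔Q =
  cong length (filter-≐ P? Q? (Equivalence.to (P⇔Q _) , Equivalence.from (P⇔Q _)) (List.tabulate id))

-- Left: the pair (j, i) counted by I (w₀ ∘ₚ σ ⁻¹ ∘ₚ w₀) at i, whose inverse acts as
-- opposite ∘ s ∘ opposite with s = σ ⟨$⟩ʳ_. Right: the pair counted by L σ at opposite i,
-- reindexed by j ↦ opposite j.
inversion⇔reflected-lehmer : (s : Fin n → Fin n) (i j : Fin n) →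
  ((j <ᶠ i) × (opposite (s (opposite i)) <ᶠ opposite (s (opposite j))))
    ⇔ ((opposite i <ᶠ opposite j) × (s (opposite j) <ᶠ s (opposite i)))
inversion⇔reflected-lehmer s i j =
  mk⇔ (map opposite-mono-< opposite-cancel-<) (map opposite-cancel-< opposite-mono-<)

proposition1 : ∀ n (σ : Permutation′ n) → I (w₀ ∘ₚ (σ ⁻¹) ∘ₚ w₀) ≡ reverse (L σ)
proposition1 n σ =
  trans (tabulate-cong λ i → trans (count-cong _ _ (inversion⇔reflected-lehmer (σ ⟨$⟩ʳ_) i))
                                   (sym (count-permute {n} w₀ _ _)))
        (sym (reverse-tabulate _))
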